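{- The family $\mathfrak{F}^*=\{\tilde{\omega},\tilde{\omega^*}\}\cup\{\tilde{L}_n:n\ge 2\}$ is $\mathbf{PL}$-learnable.
   Context: $\omega$ and $\omega^*$ denote the linear orders of order type of the natural numbers and of the negative integers; $L_n$ is the finite linear order with exactly $n$ elements. For a partial order $L$, $\tilde{L}$ is $L$ together with infinitely many new elements that are pairwise incomparable and incomparable with every element of $L$. All structures are countable with domain $\mathbb{N}$ (finite relational signature), identified with atomic diagrams; $\mathcal{S}\restriction_s$ is the finite substructure on $\{0,\dots,s\}$. For a family $\mathfrak{K}$ of pairwise nonisomorphic countable structures, $\mathrm{LD}(\mathfrak{K})$ is the set of structures isomorphic to a member of $\mathfrak{K}$ and $\mathrm{HS}(\mathfrak{K})=\{\ulcorner\mathcal{A}\urcorner:\mathcal{A}\in\mathfrak{K}\}\cup\{?\}$. A learner is an arbitrary function $\mathbf{M}$ from $\{\mathcal{S}\restriction_s:\mathcal{S}\in\mathrm{LD}(\mathfrak{K})\}$ to $\mathrm{HS}(\mathfrak{K})$. $\mathfrak{K}$ is $\mathbf{PL}$-learnable if some learner satisfies, for all $\mathcal{S}\in\mathrm{LD}(\mathfrak{K})$, $\mathcal{A}\in\mathfrak{K}$: $\{n:\mathbf{M}(\mathcal{S}\restriction_n)=\ulcorner\mathcal{A}\urcorner\}$ is infinite iff $\mathcal{S}\cong\mathcal{A}$. -}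

module Defs where

open import Data.Nat using (ℕ; zero; suc; _≤_; _≡ᵇ_; _<ᵇ_; _%_)
open import Data.Bool using (Bool; true; false; _∧_; _∨_; not)
open import Data.Fin using (Fin; toℕ)
open import Data.Vec using (Vec; tabulate)
open import Data.Maybe using (Maybe; just; nothing)
open import Data.Product using (Σ; ∃; _×_; _,_)
open import Function.Bundles using (_↔_; Inverse)
open import Relation.Binary.PropositionalEquality using (_≡_)

-- A countable structure in the signature of partial orders, with domain ℕ,
-- identified with its atomic diagram: the truth value of x ≤ y.
Structure : Set
Structure = ℕ → ℕ → Bool

_≅_ : Structure → Structure → Set
S ≅ T = Σ (ℕ ↔ ℕ) λ f → ∀ x y → S x y ≡ T (Inverse.to f x) (Inverse.to f y)

FinStructure : ℕ → Set
FinStructure s = Vec (Vec Bool (suc s)) (suc s)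

_↾_ : Structure → (s : ℕ) → FinStructure s
(S ↾ s) = tabulate λ i → tabulate λ j → S (toℕ i) (toℕ j)

_≤ᵇ_ : ℕ → ℕ → Bool
x ≤ᵇ y = (x <ᵇ y) ∨ (x ≡ᵇ y)

isEven : ℕ → Bool
isEven x = (x % 2) ≡ᵇ 0

-- Presentations on ℕ (non-strict partial orders).
-- ω̃ : the even numbers form a copy of ω (2k ≤ 2m iff k ≤ m); the odd
-- numbers are the infinitely many extra pairwise incomparable elements.
omegaTilde : Structure
omegaTilde x y = (x ≡ᵇ y) ∨ (isEven x ∧ isEven y ∧ (x ≤ᵇ y))

omegaStarTilde : Structure
omegaStarTilde x y = (x ≡ᵇ y) ∨ (isEven x ∧ isEven y ∧ (y ≤ᵇ x))

LnTilde : ℕ → Structure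
LnTilde n x y = (x ≡ᵇ y) ∨ ((x <ᵇ n) ∧ (y <ᵇ n) ∧ (x ≤ᵇ y))

-- Indices of the family 𝔉* = {ω̃, ω*~} ∪ {L̃ₙ : n ≥ 2}.
-- finL k stands for L̃_(k+2), so that k ranges over all n ≥ 2 exactly once.
data Idx : Set where
  ω̃ ω*̃ : Idx
  finL : ℕ → Idx

member : Idx → Structure
member ω̃ = omegaTilde
member ω*̃ = omegaStarTilde
member (finL k) = LnTilde (suc (suc k))

-- Hypothesis space HS(𝔉*): codes of members, plus '?' (= nothing).
HS : Set
HS = Maybe Idx

LD : Structure → Set
LD S = ∃ λ i → S ≅ member i

Learner : Set
Learner = (s : ℕ) → FinStructure s → HS

InfinitelyMany : (ℕ → Set) → Set
InfinitelyMany P = ∀ m → ∃ λ n → m ≤ n × P n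

PLLearns : Learner → Set
PLLearns M = ∀ (S : Structure) → LD S → ∀ (i : Idx) →
  (InfinitelyMany (λ n → M n (S ↾ n) ≡ just i) → S ≅ member i)
  × (S ≅ member i → InfinitelyMany (λ n → M n (S ↾ n) ≡ just i))

PLLearnable : Set
PLLearnable = ∃ λ (M : Learner) → PLLearns M

-- In every member of 𝔉* the elements comparable with some other element form
-- the chain and all others are isolated.  At stage s the learner looks at the
-- newest element s: if it is comparable with an earlier element and lies above
-- all of them it guesses ω̃, if it lies below all of them it guesses ω*̃, and
-- otherwise it guesses L̃ₙ for n the number of chain elements seen so far.
-- In a copy of ω̃ new maxima keep arriving, no new minimum arrives once the
-- least element has, and the number of chain elements seen grows without
-- bound; ω*̃ is the mirror image.  In a copy of L̃ₙ every element arriving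
-- after the whole chain is isolated, so from then on the guess is L̃ₙ.
module Submission where

open import Defs
open import Algebra.Bundles using (CommutativeMonoid)
import Algebra.Properties.CommutativeSemigroup as CommutativeSemigroupProperties
open import Data.Bool using (Bool; true; false; _∧_; _∨_; not)
open import Data.Bool.Properties
  using (∧-zeroʳ; ∧-identityʳ; ∨-zeroʳ; ∨-identityʳ; ∨-comm; ∧-conicalʳ; not-¬; ∧-commutativeMonoid)
import Data.Bool.Properties as Bool
open import Data.Empty using (⊥-elim)
open import Data.Fin using (fromℕ<; toℕ)
open import Data.Fin.Properties using (toℕ-fromℕ<)
open import Data.Maybe using (just; nothing)
open import Data.Maybe.Properties using (just-injective)
open import Data.Nat using (ℕ; zero; suc; _+_; _≤_; _<_; _⊔_; z≤n; s≤s; z<s; _≡ᵇ_; _<ᵇ_; _%_)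
open import Data.Nat.DivMod using ([m+n]%n≡m%n)
open import Data.Nat.Properties
  using (_≟_; _<?_; _≤?_; ≤-refl; ≤-trans; <-≤-trans; ≤-<-trans; <⇒≤; <⇒≢; <-irrefl; ≰⇒>;
         n<1+n; m<n⇒m<1+n; m≤n⇒m≤1+n; m<1+n⇒m<n∨m≡n; m<1+n⇒m≤n; m≤n⇒m<n∨m≡n; m≤m⊔n; m≤n⊔m;
         +-comm; +-identityʳ; +-mono-≤; +-commutativeSemigroup; module ≤-Reasoning)
open import Data.Product using (∃; _×_; _,_; proj₁; proj₂)
open import Data.Sum using (_⊎_; inj₁; inj₂; [_,_]′; swap)
open import Data.Vec using (lookup; tabulate)
open import Data.Vec.Properties using (lookup∘tabulate)
open import Function using (_∘_; flip)
open import Function.Bundles using (_↔_; Inverse)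
open import Relation.Binary.PropositionalEquality
  using (_≡_; _≢_; refl; sym; trans; cong; cong₂; subst; module ≡-Reasoning)
open import Relation.Nullary using (¬_; yes; no)
open import Relation.Nullary.Decidable using (dec-true; dec-false; _×-dec_)
open import Relation.Unary using (Decidable)

-- does (m ≟ n) and does (m <? n) compute to m ≡ᵇ n and m <ᵇ n, so dec-true and
-- dec-false evaluate the Boolean tests used by Defs.
≡ᵇ-refl : ∀ a → (a ≡ᵇ a) ≡ true
≡ᵇ-refl a = dec-true (a ≟ a) refl

≢⇒≡ᵇ-false : ∀ {a b} → a ≢ b → (a ≡ᵇ b) ≡ false
≢⇒≡ᵇ-false {a} {b} = dec-false (a ≟ b)

≤⇒≤ᵇ : ∀ {a b} → a ≤ b → (a ≤ᵇ b) ≡ true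
≤⇒≤ᵇ {a} {b} a≤b with m≤n⇒m<n∨m≡n a≤b
... | inj₁ a<b rewrite dec-true (a <? b) a<b = refl
... | inj₂ refl rewrite ≡ᵇ-refl a = ∨-zeroʳ (a <ᵇ a)

≡ᵇ-sym : ∀ a b → (a ≡ᵇ b) ≡ (b ≡ᵇ a)
≡ᵇ-sym a b with a ≟ b
... | yes refl = refl
... | no a≢b = trans (≢⇒≡ᵇ-false a≢b) (sym (≢⇒≡ᵇ-false (a≢b ∘ sym)))

≤ᵇ-total : ∀ a b → (a ≤ᵇ b) ∨ (b ≤ᵇ a) ≡ true
≤ᵇ-total zero zero = refl
≤ᵇ-total zero (suc b) = refl
≤ᵇ-total (suc a) zero = refl
≤ᵇ-total (suc a) (suc b) = ≤ᵇ-total a b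

∨≡true : ∀ a b → a ∨ b ≡ true → a ≡ true ⊎ b ≡ true
∨≡true true _ _ = inj₁ refl
∨≡true false _ b≡true = inj₂ b≡true

anyBelow : ℕ → (ℕ → Bool) → Bool
anyBelow zero p = false
anyBelow (suc n) p = anyBelow n p ∨ p n

allBelow : ℕ → (ℕ → Bool) → Bool
allBelow zero p = true
allBelow (suc n) p = allBelow n p ∧ p n

bit : Bool → ℕ
bit true = 1
bit false = 0

countBelow : ℕ → (ℕ → Bool) → ℕ
countBelow zero p = 0
countBelow (suc n) p = countBelow n p + bit (p n)

maxBelow : ℕ → (ℕ → ℕ) → ℕ
maxBelow zero h = 0
maxBelow (suc n) h = maxBelow n h ⊔ h n

_≗_below_ : (ℕ → Bool) → (ℕ → Bool) → ℕ → Set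
p ≗ q below n = ∀ y → y < n → p y ≡ q y

private
  below-pred : ∀ {p q n} → p ≗ q below suc n → p ≗ q below n
  below-pred p≗q y y<n = p≗q y (m<n⇒m<1+n y<n)

anyBelow-cong : ∀ n {p q} → p ≗ q below n → anyBelow n p ≡ anyBelow n q
anyBelow-cong zero _ = refl
anyBelow-cong (suc n) p≗q = cong₂ _∨_ (anyBelow-cong n (below-pred p≗q)) (p≗q n ≤-refl)

allBelow-cong : ∀ n {p q} → p ≗ q below n → allBelow n p ≡ allBelow n q
allBelow-cong zero _ = refl
allBelow-cong (suc n) p≗q = cong₂ _∧_ (allBelow-cong n (below-pred p≗q)) (p≗q n ≤-refl)

countBelow-cong : ∀ n {p q} → p ≗ q below n → countBelow n p ≡ countBelow n q
countBelow-cong zero _ = refl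
countBelow-cong (suc n) p≗q = cong₂ _+_ (countBelow-cong n (below-pred p≗q)) (cong bit (p≗q n ≤-refl))

anyBelow-intro : ∀ {n p y} → y < n → p y ≡ true → anyBelow n p ≡ true
anyBelow-intro {suc n} {p} y<1+n py with m<1+n⇒m<n∨m≡n y<1+n
... | inj₁ y<n = cong (_∨ p n) (anyBelow-intro y<n py)
... | inj₂ refl = trans (cong (anyBelow n p ∨_) py) (∨-zeroʳ _)

anyBelow-false : ∀ n {p} → (∀ y → y < n → p y ≡ false) → anyBelow n p ≡ false
anyBelow-false zero _ = refl
anyBelow-false (suc n) none = cong₂ _∨_ (anyBelow-false n (λ y y<n → none y (m<n⇒m<1+n y<n))) (none n ≤-refl)

allBelow-true : ∀ n {p} → (∀ y → y < n → p y ≡ true) → allBelow n p ≡ true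
allBelow-true zero _ = refl
allBelow-true (suc n) all = cong₂ _∧_ (allBelow-true n (λ y y<n → all y (m<n⇒m<1+n y<n))) (all n ≤-refl)

allBelow-elim : ∀ {n p y} → y < n → p y ≡ false → allBelow n p ≡ false
allBelow-elim {suc n} {p} y<1+n py with m<1+n⇒m<n∨m≡n y<1+n
... | inj₁ y<n = cong (_∧ p n) (allBelow-elim y<n py)
... | inj₂ refl = trans (cong (allBelow n p ∧_) py) (∧-zeroʳ _)

countBelow-false : ∀ n {p} → (∀ y → y < n → p y ≡ false) → countBelow n p ≡ 0
countBelow-false zero _ = refl
countBelow-false (suc n) none = cong₂ _+_ (countBelow-false n (λ y y<n → none y (m<n⇒m<1+n y<n))) (cong bit (none n ≤-refl))

countBelow-true : ∀ n → countBelow n (λ _ → true) ≡ n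
countBelow-true zero = refl
countBelow-true (suc n) = trans (cong (_+ 1) (countBelow-true n)) (+-comm n 1)

countBelow-mono : ∀ n {p q} → (∀ y → y < n → p y ≡ true → q y ≡ true) → countBelow n p ≤ countBelow n q
countBelow-mono zero _ = z≤n
countBelow-mono (suc n) {p} {q} p⇒q =
  +-mono-≤ (countBelow-mono n (λ y y<n → p⇒q y (m<n⇒m<1+n y<n))) (bit-mono (p n) (q n) (p⇒q n ≤-refl))
  where
  bit-mono : ∀ a b → (a ≡ true → b ≡ true) → bit a ≤ bit b
  bit-mono false _ _ = z≤n
  bit-mono true b a⇒b rewrite a⇒b refl = ≤-refl

countBelow-+ : ∀ n {p q r} → (∀ y → y < n → bit (p y) ≡ bit (q y) + bit (r y)) →
               countBelow n p ≡ countBelow n q + countBelow n r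
countBelow-+ zero _ = refl
countBelow-+ (suc n) {p} {q} {r} split = begin
  countBelow n p + bit (p n)
    ≡⟨ cong₂ _+_ (countBelow-+ n (λ y y<n → split y (m<n⇒m<1+n y<n))) (split n ≤-refl) ⟩
  (countBelow n q + countBelow n r) + (bit (q n) + bit (r n))
    ≡⟨ CommutativeSemigroupProperties.interchange +-commutativeSemigroup
         (countBelow n q) (countBelow n r) (bit (q n)) (bit (r n)) ⟩
  (countBelow n q + bit (q n)) + (countBelow n r + bit (r n)) ∎
  where open ≡-Reasoning

countBelow-point : ∀ {n z} b → z < n → countBelow n (λ y → (y ≡ᵇ z) ∧ b) ≡ bit b
countBelow-point {suc n} {z} b z<1+n with m<1+n⇒m<n∨m≡n z<1+n
... | inj₁ z<n rewrite countBelow-point b z<n | ≢⇒≡ᵇ-false (<⇒≢ z<n ∘ sym) = +-identityʳ (bit b)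
... | inj₂ refl rewrite countBelow-false n (λ y y<n → cong (_∧ b) (≢⇒≡ᵇ-false (<⇒≢ y<n))) | ≡ᵇ-refl z = refl

bit-<ᵇ-suc : ∀ u N (g : ℕ → Bool) → bit ((u <ᵇ suc N) ∧ g u) ≡ bit ((u <ᵇ N) ∧ g u) + bit ((u ≡ᵇ N) ∧ g N)
bit-<ᵇ-suc zero zero g = refl
bit-<ᵇ-suc zero (suc N) g = sym (+-identityʳ _)
bit-<ᵇ-suc (suc u) zero g = refl
bit-<ᵇ-suc (suc u) (suc N) g = bit-<ᵇ-suc u N (g ∘ suc)

≤-maxBelow : ∀ {n} h {y} → y < n → h y ≤ maxBelow n h
≤-maxBelow {suc n} h y<1+n with m<1+n⇒m<n∨m≡n y<1+n
... | inj₁ y<n = ≤-trans (≤-maxBelow h y<n) (m≤m⊔n _ _)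
... | inj₂ refl = m≤n⊔m (maxBelow n h) _

leastBelow : ∀ {P : ℕ → Set} → Decidable P → ∀ n →
             (∀ y → y < n → ¬ P y) ⊎ ∃ λ r → r < n × P r × (∀ y → y < r → ¬ P y)
leastBelow P? zero = inj₁ (λ _ ())
leastBelow P? (suc n) with leastBelow P? n
... | inj₂ (r , r<n , Pr , least) = inj₂ (r , m<n⇒m<1+n r<n , Pr , least)
... | inj₁ none with P? n
...   | yes Pn = inj₂ (n , ≤-refl , Pn , none)
...   | no ¬Pn = inj₁ λ y y<1+n → [ none y , (λ { refl → ¬Pn }) ]′ (m<1+n⇒m<n∨m≡n y<1+n)

leastWitness : ∀ {P : ℕ → Set} → Decidable P → ∀ {x} → P x → ∃ λ r → P r × (∀ y → y < r → ¬ P y)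
leastWitness P? {x} Px with leastBelow P? (suc x)
... | inj₁ none = ⊥-elim (none x ≤-refl Px)
... | inj₂ (r , _ , Pr , least) = r , Pr , least

-- The learner

comparable : Structure → ℕ → ℕ → Bool
comparable S a b = not (a ≡ᵇ b) ∧ (S a b ∨ S b a)

hasEarlierNeighbour : Structure → ℕ → Bool
hasEarlierNeighbour S s = anyBelow s (λ y → comparable S y s)

isNewMax : Structure → ℕ → Bool
isNewMax S s = hasEarlierNeighbour S s ∧ allBelow s (λ y → not (comparable S y s) ∨ S y s)

isNewMin : Structure → ℕ → Bool
isNewMin S s = hasEarlierNeighbour S s ∧ allBelow s (λ y → not (comparable S y s) ∨ S s y)

inChain : Structure → ℕ → ℕ → Bool
inChain S s x = anyBelow (suc s) (comparable S x)

chainSize : Structure → ℕ → ℕ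
chainSize S s = countBelow (suc s) (inChain S s)

finiteGuess : ℕ → HS
finiteGuess (suc (suc k)) = just (finL k)
finiteGuess _ = nothing

guess : Bool → Bool → ℕ → HS
guess true _ _ = just ω̃
guess false true _ = just ω*̃
guess false false c = finiteGuess c

learnAt : Structure → ℕ → HS
learnAt S s = guess (isNewMax S s) (isNewMin S s) (chainSize S s)

guess-cong : ∀ {u u′ d d′ c c′} → u ≡ u′ → d ≡ d′ → c ≡ c′ → guess u d c ≡ guess u′ d′ c′
guess-cong refl refl refl = refl

guess≡ω̃ : ∀ {u d c} → guess u d c ≡ just ω̃ → u ≡ true
guess≡ω̃ {true} _ = refl
guess≡ω̃ {false} {true} ()
guess≡ω̃ {false} {false} {suc (suc c)} ()

guess≡ω*̃ : ∀ {u d c} → guess u d c ≡ just ω*̃ → d ≡ true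
guess≡ω*̃ {true} ()
guess≡ω*̃ {false} {true} _ = refl
guess≡ω*̃ {false} {false} {suc (suc c)} ()

guess≡finL : ∀ {u d c k} → guess u d c ≡ just (finL k) → c ≡ suc (suc k)
guess≡finL {true} ()
guess≡finL {false} {true} ()
guess≡finL {false} {false} {suc (suc c)} refl = refl

AgreeUpTo : ℕ → Structure → Structure → Set
AgreeUpTo s S T = ∀ a b → a ≤ s → b ≤ s → S a b ≡ T a b

module _ {s : ℕ} {S T : Structure} (agree : AgreeUpTo s S T) where

  comparable-local : ∀ {a b} → a ≤ s → b ≤ s → comparable S a b ≡ comparable T a b
  comparable-local {a} {b} a≤s b≤s =
    cong₂ (λ u v → not (a ≡ᵇ b) ∧ (u ∨ v)) (agree a b a≤s b≤s) (agree b a b≤s a≤s)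

  learnAt-local : learnAt S s ≡ learnAt T s
  learnAt-local = guess-cong (cong₂ _∧_ earlier (allBelow-cong s λ y y<s →
                                notComparableOr (<⇒≤ y<s) (agree y s (<⇒≤ y<s) ≤-refl)))
                             (cong₂ _∧_ earlier (allBelow-cong s λ y y<s →
                                notComparableOr (<⇒≤ y<s) (agree s y ≤-refl (<⇒≤ y<s))))
                             (countBelow-cong (suc s) λ x x<1+s → anyBelow-cong (suc s) λ y y<1+s →
                                comparable-local (m<1+n⇒m≤n x<1+s) (m<1+n⇒m≤n y<1+s))
    where
    earlier : hasEarlierNeighbour S s ≡ hasEarlierNeighbour T s
    earlier = anyBelow-cong s λ y y<s → comparable-local (<⇒≤ y<s) ≤-refl

    notComparableOr : ∀ {y r r′} → y ≤ s → r ≡ r′ → not (comparable S y s) ∨ r ≡ not (comparable T y s) ∨ r′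
    notComparableOr y≤s = cong₂ (λ c r → not c ∨ r) (comparable-local y≤s ≤-refl)

comparable-flip : ∀ S a b → comparable (flip S) a b ≡ comparable S a b
comparable-flip S a b = cong (not (a ≡ᵇ b) ∧_) (∨-comm (S b a) (S a b))

learnAt-flip : ∀ S s → learnAt (flip S) s ≡ guess (isNewMin S s) (isNewMax S s) (chainSize S s)
learnAt-flip S s =
  guess-cong (cong₂ _∧_ earlier (allBelow-cong s λ y _ → cong (λ c → not c ∨ S s y) (comparable-flip S y s)))
             (cong₂ _∧_ earlier (allBelow-cong s λ y _ → cong (λ c → not c ∨ S y s) (comparable-flip S y s)))
             (countBelow-cong (suc s) λ x _ → anyBelow-cong (suc s) λ y _ → comparable-flip S x y)
  where
  earlier : hasEarlierNeighbour (flip S) s ≡ hasEarlierNeighbour S s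
  earlier = anyBelow-cong s λ y _ → comparable-flip S y s

isNewMax-isolated : ∀ {S s} → hasEarlierNeighbour S s ≡ false → isNewMax S s ≡ false
isNewMax-isolated {S} {s} isolated = cong (_∧ allBelow s (λ y → not (comparable S y s) ∨ S y s)) isolated

isNewMin-isolated : ∀ {S s} → hasEarlierNeighbour S s ≡ false → isNewMin S s ≡ false
isNewMin-isolated {S} {s} isolated = cong (_∧ allBelow s (λ y → not (comparable S y s) ∨ S s y)) isolated

learnAt-isolated : ∀ {S s} → hasEarlierNeighbour S s ≡ false → learnAt S s ≡ finiteGuess (chainSize S s)
learnAt-isolated {S} {s} isolated = guess-cong (isNewMax-isolated {S} {s} isolated) (isNewMin-isolated {S} {s} isolated) refl

isNewMax-intro : ∀ {S s y} → y < s → comparable S y s ≡ true →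
                 (∀ z → z < s → comparable S z s ≡ true → S z s ≡ true) → isNewMax S s ≡ true
isNewMax-intro {S} {s} y<s neighbour below =
  cong₂ _∧_ (anyBelow-intro y<s neighbour) (allBelow-true s λ z z<s′ → below′ z (comparable S z s) refl z<s′)
  where
  below′ : ∀ z c → comparable S z s ≡ c → z < s → not c ∨ S z s ≡ true
  below′ z false _ _ = refl
  below′ z true c≡true z<s′ = below z z<s′ c≡true

isNewMin-elim : ∀ {S s y} → y < s → comparable S y s ≡ true → S s y ≡ false → isNewMin S s ≡ false
isNewMin-elim {S} {s} y<s neighbour above =
  trans (cong (hasEarlierNeighbour S s ∧_) (allBelow-elim y<s (cong₂ (λ c r → not c ∨ r) neighbour above))) (∧-zeroʳ _)

decode : (s : ℕ) → FinStructure s → Structure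
decode s D a b with a <? suc s | b <? suc s
... | yes a<1+s | yes b<1+s = lookup (lookup D (fromℕ< a<1+s)) (fromℕ< b<1+s)
... | _ | _ = false

decode-↾ : ∀ S s → AgreeUpTo s (decode s (S ↾ s)) S
decode-↾ S s a b a≤s b≤s with a <? suc s | b <? suc s
... | yes a<1+s | yes b<1+s = begin
  lookup (lookup (S ↾ s) (fromℕ< a<1+s)) (fromℕ< b<1+s)
    ≡⟨ cong (λ row → lookup row (fromℕ< b<1+s))
            (lookup∘tabulate (λ i → tabulate (λ j → S (toℕ i) (toℕ j))) (fromℕ< a<1+s)) ⟩
  lookup (tabulate (λ j → S (toℕ (fromℕ< a<1+s)) (toℕ j))) (fromℕ< b<1+s)
    ≡⟨ lookup∘tabulate (λ j → S (toℕ (fromℕ< a<1+s)) (toℕ j)) (fromℕ< b<1+s) ⟩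
  S (toℕ (fromℕ< a<1+s)) (toℕ (fromℕ< b<1+s))
    ≡⟨ cong₂ S (toℕ-fromℕ< a<1+s) (toℕ-fromℕ< b<1+s) ⟩
  S a b ∎
  where open ≡-Reasoning
... | no a≮1+s | _ = ⊥-elim (a≮1+s (s≤s a≤s))
... | yes _ | no b≮1+s = ⊥-elim (b≮1+s (s≤s b≤s))

learner : Learner
learner s D = learnAt (decode s D) s

Eventually : (ℕ → Set) → Set
Eventually P = ∃ λ m → ∀ n → m ≤ n → P n

infinitelyMany-∩-eventually : ∀ {P Q : ℕ → Set} → InfinitelyMany P → Eventually Q →
                              InfinitelyMany (λ n → P n × Q n)
infinitelyMany-∩-eventually infinite (m₀ , eventually) m with infinite (m ⊔ m₀)
... | n , m⊔m₀≤n , Pn =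
  n , ≤-trans (m≤m⊔n m m₀) m⊔m₀≤n , Pn , eventually n (≤-trans (m≤n⊔m m m₀) m⊔m₀≤n)

eventually⇒infinitelyMany : ∀ {P : ℕ → Set} → Eventually P → InfinitelyMany P
eventually⇒infinitelyMany (m₀ , eventually) m = m ⊔ m₀ , m≤m⊔n m m₀ , eventually _ (m≤n⊔m m m₀)

eventually⇒¬infinitelyMany : ∀ {P Q : ℕ → Set} → Eventually P → (∀ {n} → P n → ¬ Q n) → ¬ InfinitelyMany Q
eventually⇒¬infinitelyMany eventually P⇒¬Q infinite with infinitelyMany-∩-eventually infinite eventually 0
... | _ , _ , Qn , Pn = P⇒¬Q Pn Qn

Learns : (ℕ → HS) → Idx → Set
Learns o j = (∀ i → InfinitelyMany (λ n → o n ≡ just i) → i ≡ j) × InfinitelyMany (λ n → o n ≡ just j)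

Learns-cong : ∀ {o o′ j} → (∀ n → o n ≡ o′ n) → Learns o′ j → Learns o j
Learns-cong o≗o′ (only , often) =
  (λ i infinite → only i λ m → let (n , m≤n , eq) = infinite m in n , m≤n , trans (sym (o≗o′ n)) eq) ,
  (λ m → let (n , m≤n , eq) = often m in n , m≤n , trans (o≗o′ n) eq)

Learns-eventually : ∀ {o j} → Eventually (λ n → o n ≡ just j) → Learns o j
Learns-eventually eventually =
  (λ i infinite → let (_ , _ , oi , oj) = infinitelyMany-∩-eventually infinite eventually 0
                  in just-injective (trans (sym oi) oj)) ,
  eventually⇒infinitelyMany eventually

module _ {u d : ℕ → Bool} {c : ℕ → ℕ}
         (minimaStop : Eventually (λ n → d n ≡ false))
         (maximaRecur : InfinitelyMany (λ n → u n ≡ true))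
         (sizeGrows : ∀ k → Eventually (λ n → k < c n)) where

  private
    finiteGuessesStop : ∀ {o : ℕ → HS} k → (∀ {n} → o n ≡ just (finL k) → c n ≡ suc (suc k)) →
                        ¬ InfinitelyMany (λ n → o n ≡ just (finL k))
    finiteGuessesStop k sized = eventually⇒¬infinitelyMany (sizeGrows (suc (suc k)))
                                  λ k<c eq → <-irrefl (sym (sized eq)) k<c

  guess-learns-ω̃ : Learns (λ n → guess (u n) (d n) (c n)) ω̃
  guess-learns-ω̃ = only , λ m → let (n , m≤n , un) = maximaRecur m in n , m≤n , cong (λ b → guess b (d n) (c n)) un
    where
    only : ∀ i → InfinitelyMany (λ n → guess (u n) (d n) (c n) ≡ just i) → i ≡ ω̃
    only ω̃ _ = refl
    only ω*̃ infinite = ⊥-elim (eventually⇒¬infinitelyMany minimaStop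
                                  (λ {n} dn → not-¬ dn ∘ guess≡ω*̃ {u n}) infinite)
    only (finL k) infinite = ⊥-elim (finiteGuessesStop k (λ {n} → guess≡finL {u n} {d n}) infinite)

  guess-learns-ω*̃ : Learns (λ n → guess (d n) (u n) (c n)) ω*̃
  guess-learns-ω*̃ = only , often
    where
    only : ∀ i → InfinitelyMany (λ n → guess (d n) (u n) (c n) ≡ just i) → i ≡ ω*̃
    only ω̃ infinite = ⊥-elim (eventually⇒¬infinitelyMany minimaStop
                                 (λ {n} dn → not-¬ dn ∘ guess≡ω̃ {d n} {u n} {c n}) infinite)
    only ω*̃ _ = refl
    only (finL k) infinite = ⊥-elim (finiteGuessesStop k (λ {n} → guess≡finL {d n} {u n}) infinite)

    often : InfinitelyMany (λ n → guess (d n) (u n) (c n) ≡ just ω*̃)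
    often m with infinitelyMany-∩-eventually maximaRecur minimaStop m
    ... | n , m≤n , un , dn = n , m≤n , guess-cong dn un refl

-- Chains with isolated points

chainWith : (ℕ → Bool) → Structure
chainWith ch a b = (a ≡ᵇ b) ∨ (ch a ∧ ch b ∧ (a ≤ᵇ b))

chainWith-≤ᵇ : ∀ {ch u v} → ch u ≡ true → ch v ≡ true → (u ≤ᵇ v) ≡ true → chainWith ch u v ≡ true
chainWith-≤ᵇ {u = u} {v} chu chv u≤ᵇv rewrite chu | chv | u≤ᵇv = ∨-zeroʳ (u ≡ᵇ v)

chainWith-≤ : ∀ {ch u v} → ch u ≡ true → ch v ≡ true → u ≤ v → chainWith ch u v ≡ true
chainWith-≤ {ch} {u} {v} chu chv = chainWith-≤ᵇ {ch} {u} {v} chu chv ∘ ≤⇒≤ᵇ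

chainWith-total : ∀ {ch u v} → ch u ≡ true → ch v ≡ true → chainWith ch u v ∨ chainWith ch v u ≡ true
chainWith-total {ch} {u} {v} chu chv with ∨≡true (u ≤ᵇ v) (v ≤ᵇ u) (≤ᵇ-total u v)
... | inj₁ u≤ᵇv = cong (_∨ chainWith ch v u) (chainWith-≤ᵇ {ch} {u} {v} chu chv u≤ᵇv)
... | inj₂ v≤ᵇu = trans (cong (chainWith ch u v ∨_) (chainWith-≤ᵇ {ch} {v} {u} chv chu v≤ᵇu)) (∨-zeroʳ _)

chainWith-outside : ∀ {ch u v} → ch u ≡ false ⊎ ch v ≡ false → chainWith ch u v ≡ (u ≡ᵇ v)
chainWith-outside {ch} {u} {v} (inj₁ chu) rewrite chu = ∨-identityʳ (u ≡ᵇ v)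
chainWith-outside {ch} {u} {v} (inj₂ chv) rewrite chv | ∧-zeroʳ (ch u) = ∨-identityʳ (u ≡ᵇ v)

comparable-chainWith-outside : ∀ {ch u v} → ch u ≡ false ⊎ ch v ≡ false → comparable (chainWith ch) u v ≡ false
comparable-chainWith-outside {ch} {u} {v} outside =
  trans (cong₂ (λ a b → not (u ≡ᵇ v) ∧ (a ∨ b)) (chainWith-outside {ch} {u} {v} outside)
                                                (trans (chainWith-outside {ch} {v} {u} (swap outside)) (≡ᵇ-sym v u)))
        (distinct-∧-equal (u ≡ᵇ v))
  where
  distinct-∧-equal : ∀ e → not e ∧ (e ∨ e) ≡ false
  distinct-∧-equal true = refl
  distinct-∧-equal false = refl

comparable-chainWith-inside : ∀ {ch u v} → ch u ≡ true → ch v ≡ true → comparable (chainWith ch) u v ≡ not (u ≡ᵇ v)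
comparable-chainWith-inside {ch} {u} {v} chu chv =
  trans (cong (not (u ≡ᵇ v) ∧_) (chainWith-total {ch} {u} {v} chu chv)) (∧-identityʳ _)

omegaTilde-below-0 : ∀ {u} → u ≢ 0 → omegaTilde u 0 ≡ false
omegaTilde-below-0 {zero} u≢0 = ⊥-elim (u≢0 refl)
omegaTilde-below-0 {suc u} _ = ∧-zeroʳ (isEven (suc u))

omegaStarTilde-flip : ∀ u v → omegaStarTilde u v ≡ omegaTilde v u
omegaStarTilde-flip u v =
  cong₂ _∨_ (≡ᵇ-sym u v)
            (CommutativeSemigroupProperties.x∙yz≈y∙xz
               (CommutativeMonoid.commutativeSemigroup ∧-commutativeMonoid) (isEven u) (isEven v) (v ≤ᵇ u))

module Along (f : ℕ ↔ ℕ) where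

  t : ℕ → ℕ
  t = Inverse.to f

  t⁻¹ : ℕ → ℕ
  t⁻¹ = Inverse.from f

  t-t⁻¹ : ∀ v → t (t⁻¹ v) ≡ v
  t-t⁻¹ = Inverse.strictlyInverseˡ f

  t⁻¹-t : ∀ x → t⁻¹ (t x) ≡ x
  t⁻¹-t = Inverse.strictlyInverseʳ f

  along : Structure → Structure
  along A x y = A (t x) (t y)

  t-≡ᵇ : ∀ x v → (t x ≡ᵇ v) ≡ (x ≡ᵇ t⁻¹ v)
  t-≡ᵇ x v with x ≟ t⁻¹ v
  ... | yes refl = trans (dec-true (t (t⁻¹ v) ≟ v) (t-t⁻¹ v)) (sym (≡ᵇ-refl (t⁻¹ v)))
  ... | no x≢t⁻¹v = trans (dec-false (t x ≟ v) λ tx≡v → x≢t⁻¹v (trans (sym (t⁻¹-t x)) (cong t⁻¹ tx≡v)))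
                          (sym (≢⇒≡ᵇ-false x≢t⁻¹v))

  t-≡ᵇ-t : ∀ a b → (t a ≡ᵇ t b) ≡ (a ≡ᵇ b)
  t-≡ᵇ-t a b = trans (t-≡ᵇ a (t b)) (cong (a ≡ᵇ_) (t⁻¹-t b))

  comparable-along : ∀ A a b → comparable (along A) a b ≡ comparable A (t a) (t b)
  comparable-along A a b = cong (λ e → not e ∧ (A (t a) (t b) ∨ A (t b) (t a))) (sym (t-≡ᵇ-t a b))

  comparable-along-intro : ∀ ch {a b} → a ≢ b → ch (t a) ≡ true → ch (t b) ≡ true →
                           comparable (along (chainWith ch)) a b ≡ true
  comparable-along-intro ch {a} {b} a≢b cha chb =
    trans (comparable-along (chainWith ch) a b)
          (trans (comparable-chainWith-inside {ch} cha chb) (cong not (trans (t-≡ᵇ-t a b) (≢⇒≡ᵇ-false a≢b))))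

  not-comparable-along : ∀ ch {a b} → ch (t a) ≡ false ⊎ ch (t b) ≡ false →
                         comparable (along (chainWith ch)) a b ≡ false
  not-comparable-along ch {a} {b} outside =
    trans (comparable-along (chainWith ch) a b) (comparable-chainWith-outside {ch} outside)

  comparable-along⇒chain : ∀ ch {a b} → comparable (along (chainWith ch)) a b ≡ true → ch (t a) ≡ true
  comparable-along⇒chain ch {a} {b} cmp = byMembership (ch (t a)) refl
    where
    byMembership : ∀ c → ch (t a) ≡ c → ch (t a) ≡ true
    byMembership true cha = cha
    byMembership false cha with () ← trans (sym cmp) (not-comparable-along ch {a} {b} (inj₁ cha))

  hasEarlierNeighbour-outside : ∀ ch {s} → ch (t s) ≡ false → hasEarlierNeighbour (along (chainWith ch)) s ≡ false
  hasEarlierNeighbour-outside ch {s} chs = anyBelow-false s λ y _ → not-comparable-along ch (inj₂ chs)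

  PartnersArrivedBy : (ℕ → Bool) → ℕ → Set
  PartnersArrivedBy ch s = ∀ u → ∃ λ v → v ≢ u × ch v ≡ true × t⁻¹ v ≤ s

  partnersFromTwoPoints : ∀ ch {c s} → ch 0 ≡ true → ch (suc c) ≡ true → t⁻¹ 0 ≤ s → t⁻¹ (suc c) ≤ s →
                   PartnersArrivedBy ch s
  partnersFromTwoPoints ch {c} ch0 chc placed0 placedc zero = suc c , (λ ()) , chc , placedc
  partnersFromTwoPoints ch ch0 chc placed0 placedc (suc u) = 0 , (λ ()) , ch0 , placed0

  inChain-along : ∀ ch {s x} → PartnersArrivedBy ch s → inChain (along (chainWith ch)) s x ≡ ch (t x)
  inChain-along ch {s} {x} others = byMembership (ch (t x)) refl
    where
    byMembership : ∀ b → ch (t x) ≡ b → inChain (along (chainWith ch)) s x ≡ ch (t x)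
    byMembership false chx = trans (anyBelow-false (suc s) λ y _ → not-comparable-along ch (inj₁ chx)) (sym chx)
    byMembership true chx with others (t x)
    ... | v , v≢tx , chv , placed =
      trans (anyBelow-intro (s≤s placed)
               (comparable-along-intro ch (λ x≡t⁻¹v → v≢tx (trans (sym (t-t⁻¹ v)) (cong t (sym x≡t⁻¹v))))
                                          chx (trans (cong ch (t-t⁻¹ v)) chv)))
            (sym chx)

  chainSize-along : ∀ ch {s} → PartnersArrivedBy ch s → chainSize (along (chainWith ch)) s ≡ countBelow (suc s) (ch ∘ t)
  chainSize-along ch {s} others = countBelow-cong (suc s) λ x _ → inChain-along ch others

  countBelow-along : ∀ g N {n} → (∀ v → v < N → t⁻¹ v < n) →
                     countBelow n (λ x → (t x <ᵇ N) ∧ g (t x)) ≡ countBelow N g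
  countBelow-along g zero {n} _ = countBelow-false n λ _ _ → refl
  countBelow-along g (suc N) {n} placed = begin
    countBelow n (λ x → (t x <ᵇ suc N) ∧ g (t x))
      ≡⟨ countBelow-+ n (λ x _ → split x) ⟩
    countBelow n (λ x → (t x <ᵇ N) ∧ g (t x)) + countBelow n (λ x → (x ≡ᵇ t⁻¹ N) ∧ g N)
      ≡⟨ cong₂ _+_ (countBelow-along g N (λ v v<N → placed v (m<n⇒m<1+n v<N)))
                   (countBelow-point (g N) (placed N ≤-refl)) ⟩
    countBelow N g + bit (g N) ∎
    where
    open ≡-Reasoning
    split : ∀ x → bit ((t x <ᵇ suc N) ∧ g (t x)) ≡ bit ((t x <ᵇ N) ∧ g (t x)) + bit ((x ≡ᵇ t⁻¹ N) ∧ g N)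
    split x = trans (bit-<ᵇ-suc (t x) N g) (cong (λ e → bit ((t x <ᵇ N) ∧ g (t x)) + bit (e ∧ g N)) (t-≡ᵇ x N))

-- Copies of ω̃ and ω*̃

double : ℕ → ℕ
double zero = 0
double (suc m) = suc (suc (double m))

isEven-+2 : ∀ n → isEven (suc (suc n)) ≡ isEven n
isEven-+2 n = cong (_≡ᵇ 0) (trans (cong (_% 2) (+-comm 2 n)) ([m+n]%n≡m%n n 2))

isEven-double : ∀ m → isEven (double m) ≡ true
isEven-double zero = refl
isEven-double (suc m) = trans (isEven-+2 (double m)) (isEven-double m)

isEven-1+double : ∀ m → isEven (suc (double m)) ≡ false
isEven-1+double zero = refl
isEven-1+double (suc m) = trans (isEven-+2 (suc (double m))) (isEven-1+double m)

≤-double : ∀ m → m ≤ double m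
≤-double zero = z≤n
≤-double (suc m) = s≤s (m≤n⇒m≤1+n (≤-double m))

countBelow-isEven-double : ∀ m → countBelow (double m) isEven ≡ m
countBelow-isEven-double zero = refl
countBelow-isEven-double (suc m)
  rewrite countBelow-isEven-double m | isEven-double m | isEven-1+double m = trans (+-identityʳ (m + 1)) (+-comm m 1)

module OmegaCopy (f : ℕ ↔ ℕ) where
  open Along f

  Gω : Structure
  Gω = along (chainWith isEven)

  bottom : ℕ
  bottom = t⁻¹ 0

  bottom-neighbour : ∀ {s} → bottom < s → isEven (t s) ≡ true → comparable Gω bottom s ≡ true
  bottom-neighbour bottom<s evs = comparable-along-intro isEven (<⇒≢ bottom<s) (cong isEven (t-t⁻¹ 0)) evs

  newMinima-stop : Eventually (λ s → isNewMin Gω s ≡ false)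
  newMinima-stop = suc bottom , λ s bottom<s → byParity s bottom<s (isEven (t s)) refl
    where
    byParity : ∀ s → bottom < s → ∀ b → isEven (t s) ≡ b → isNewMin Gω s ≡ false
    byParity s _ false odd = isNewMin-isolated {Gω} {s} (hasEarlierNeighbour-outside isEven odd)
    byParity s bottom<s true even = isNewMin-elim {Gω} bottom<s (bottom-neighbour bottom<s even) above
      where
      ts≢0 : t s ≢ 0
      ts≢0 ts≡0 = <-irrefl (trans (cong t⁻¹ (sym ts≡0)) (t⁻¹-t s)) bottom<s
      above : Gω s bottom ≡ false
      above = trans (cong (omegaTilde (t s)) (t-t⁻¹ 0)) (omegaTilde-below-0 ts≢0)

  High : ℕ → ℕ → Set
  High e y = isEven (t y) ≡ true × e ≤ t y

  high? : ∀ e → Decidable (High e)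
  high? e y = (isEven (t y) Bool.≟ true) ×-dec (e ≤? t y)

  high : ∀ e → High e (t⁻¹ (double e))
  high e = trans (cong isEven (t-t⁻¹ _)) (isEven-double e) , subst (e ≤_) (sym (t-t⁻¹ _)) (≤-double e)

  -- Every earlier chain element lies below e, hence below the element arriving at r.
  firstHigh-isNewMax : ∀ {e r} → bottom < r → High e r → (∀ y → y < r → ¬ High e y) → isNewMax Gω r ≡ true
  firstHigh-isNewMax {e} {r} bottom<r (evr , e≤tr) first =
    isNewMax-intro {Gω} bottom<r (bottom-neighbour bottom<r evr) below
    where
    below : ∀ z → z < r → comparable Gω z r ≡ true → Gω z r ≡ true
    below z z<r cmp = chainWith-≤ {isEven} {t z} {t r} evz evr (<⇒≤ (<-≤-trans tz<e e≤tr))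
      where
      evz : isEven (t z) ≡ true
      evz = comparable-along⇒chain isEven cmp
      tz<e : t z < e
      tz<e = ≰⇒> λ e≤tz → first z z<r (evz , e≤tz)

  newMaxima-recur : InfinitelyMany (λ s → isNewMax Gω s ≡ true)
  newMaxima-recur m = afterM (leastWitness (high? e) (high e))
    where
    M : ℕ
    M = m ⊔ bottom
    -- e exceeds every element arriving by stage M, so no stage up to M is high.
    e : ℕ
    e = suc (maxBelow (suc M) t)
    afterM : (∃ λ r → High e r × (∀ y → y < r → ¬ High e y)) → ∃ λ r → m ≤ r × isNewMax Gω r ≡ true
    afterM (r , highr , first) =
      r , ≤-trans (m≤m⊔n m bottom) (<⇒≤ M<r) , firstHigh-isNewMax (≤-<-trans (m≤n⊔m m bottom) M<r) highr first
      where
      M<r : M < r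
      M<r = ≰⇒> λ r≤M → <-irrefl refl (≤-<-trans (proj₂ highr) (s≤s (≤-maxBelow t (s≤s r≤M))))

  chainSize-grows : ∀ k → Eventually (λ s → k < chainSize Gω s)
  chainSize-grows k = maxBelow N t⁻¹ , λ s B≤s → growth s (λ v v<N → ≤-trans (≤-maxBelow t⁻¹ v<N) B≤s)
    where
    N : ℕ
    N = double (suc (suc k))
    growth : ∀ s → (∀ v → v < N → t⁻¹ v ≤ s) → k < chainSize Gω s
    growth s placed = begin-strict
        k
          <⟨ m<n⇒m<1+n (n<1+n k) ⟩
        suc (suc k)
          ≡⟨ sym (countBelow-isEven-double (suc (suc k))) ⟩
        countBelow N isEven
          ≡⟨ sym (countBelow-along isEven N λ v v<N → s≤s (placed v v<N)) ⟩
        countBelow (suc s) (λ x → (t x <ᵇ N) ∧ isEven (t x))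
          ≤⟨ countBelow-mono (suc s) (λ x _ → ∧-conicalʳ _ _) ⟩
        countBelow (suc s) (isEven ∘ t)
          ≡⟨ sym (chainSize-along isEven partners) ⟩
        chainSize Gω s ∎
      where
      open ≤-Reasoning
      partners : PartnersArrivedBy isEven s
      partners = partnersFromTwoPoints isEven refl refl (placed 0 z<s) (placed 2 (s≤s (s≤s z<s)))

-- Copies of L̃ₙ

module FiniteCopy (f : ℕ ↔ ℕ) (k : ℕ) where
  open Along f

  n : ℕ
  n = suc (suc k)

  GL : Structure
  GL = along (chainWith (_<ᵇ n))

  lastArrival : ℕ
  lastArrival = maxBelow n t⁻¹

  guesses-L̃ₙ : Eventually (λ s → learnAt GL s ≡ just (finL k))
  guesses-L̃ₙ = suc lastArrival , λ s arrived → begin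
    learnAt GL s
      ≡⟨ learnAt-isolated {GL} {s} (hasEarlierNeighbour-outside (_<ᵇ n) (outsideChain arrived)) ⟩
    finiteGuess (chainSize GL s)
      ≡⟨ cong finiteGuess (size (<⇒≤ arrived)) ⟩
    just (finL k) ∎
    where
    open ≡-Reasoning
    placed : ∀ {s} → lastArrival ≤ s → ∀ v → v < n → t⁻¹ v ≤ s
    placed arrived v v<n = ≤-trans (≤-maxBelow t⁻¹ v<n) arrived

    outsideChain : ∀ {s} → lastArrival < s → (t s <ᵇ n) ≡ false
    outsideChain {s} arrived = dec-false (t s <? n) λ ts<n →
      <-irrefl refl (<-≤-trans arrived (subst (_≤ lastArrival) (t⁻¹-t s) (≤-maxBelow t⁻¹ ts<n)))

    size : ∀ {s} → lastArrival ≤ s → chainSize GL s ≡ n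
    size {s} arrived = begin
      chainSize GL s
        ≡⟨ chainSize-along (_<ᵇ n) partners ⟩
      countBelow (suc s) (λ x → t x <ᵇ n)
        ≡⟨ countBelow-cong (suc s) (λ x _ → sym (∧-identityʳ (t x <ᵇ n))) ⟩
      countBelow (suc s) (λ x → (t x <ᵇ n) ∧ true)
        ≡⟨ countBelow-along (λ _ → true) n (λ v v<n → s≤s (placed arrived v v<n)) ⟩
      countBelow n (λ _ → true)
        ≡⟨ countBelow-true n ⟩
      n ∎
      where
      partners : PartnersArrivedBy (_<ᵇ n) s
      partners = partnersFromTwoPoints (_<ᵇ n) refl refl (placed arrived 0 z<s) (placed arrived 1 (s≤s z<s))

learnAt-learns : ∀ S j → S ≅ member j → Learns (learnAt S) j
learnAt-learns S ω̃ (f , S≅) =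
  Learns-cong (λ s → learnAt-local {s} {S} {Gω} (λ a b _ _ → S≅ a b))
              (guess-learns-ω̃ newMinima-stop newMaxima-recur chainSize-grows)
  where open OmegaCopy f
learnAt-learns S ω*̃ (f , S≅) =
  Learns-cong (λ s → trans (learnAt-local {s} {S} {flip Gω} (λ a b _ _ → S≅flip a b)) (learnAt-flip Gω s))
              (guess-learns-ω*̃ newMinima-stop newMaxima-recur chainSize-grows)
  where
  open OmegaCopy f
  open Along f using (t)
  -- A copy of ω*̃ is the reverse of the copy of ω̃ along the same permutation.
  S≅flip : ∀ a b → S a b ≡ flip Gω a b
  S≅flip a b = trans (S≅ a b) (omegaStarTilde-flip (t a) (t b))
learnAt-learns S (finL k) (f , S≅) =
  Learns-cong (λ s → learnAt-local {s} {S} {GL} (λ a b _ _ → S≅ a b)) (Learns-eventually guesses-L̃ₙ)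
  where open FiniteCopy f k

mainTheorem17 : PLLearnable
mainTheorem17 = learner , λ S (j , S≅j) i →
  (λ often → subst (λ i → S ≅ member i) (sym (proj₁ (learns {S} {j} S≅j) i often)) S≅j) ,
  (λ S≅i → proj₂ (learns S≅i))
  where
  learns : ∀ {S j} → S ≅ member j → Learns (λ s → learner s (S ↾ s)) j
  learns {S} {j} S≅j =
    Learns-cong {j = j} (λ s → learnAt-local {s} {decode s (S ↾ s)} {S} (decode-↾ S s)) (learnAt-learns S j S≅j)
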